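{- Let $P_1$ be the morphism of the free monoid on the alphabet $\Omega_1=\{\mathtt R,\mathtt r,\mathtt L,\mathtt l,\mathtt S,\mathtt s\}$ determined by $$\mathtt R\mapsto \mathtt{Rr},\quad \mathtt r\mapsto \mathtt S,\quad \mathtt L\mapsto \mathtt S,\quad \mathtt l\mapsto \mathtt{Ll},\quad \mathtt S\mapsto \mathtt{Rl},\quad \mathtt s\mapsto \mathtt{Lr},$$ and let $a_n=\|P_1^n(\mathtt L)\|$ be the number of letters of the word $P_1^n(\mathtt L)$, for $n\ge 0$. Then $a_n$, which is the length of the right side boundary of the polyomino $\mathcal S_n$ containing the Harter–Heighway dragon curve $\mathcal C_n$, satisfies $$a_n=a_{n-1}+2a_{n-3}\quad\text{for } n\ge 4,\qquad a_0=1,\ a_1=1,\ a_2=2.$$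
   Context: $\mathcal C_n$ is the $n$-th iterate of the Harter–Heighway dragon curve (a lattice curve of $2^n$ unit segments with $90^\circ$ turns, obtained by folding a strip of paper $n$ times and opening each fold to $90^\circ$). The polyomino $\mathcal S_n$ is the union of the squares each having one edge of $\mathcal C_n$ as a diagonal. It is known (from earlier work) that the right side boundary of $\mathcal S_n$ is traced, edge by edge, by the word $P_1^n(\mathtt L)$ interpreted in turtle geometry, so that its length is $a_n$. -}

module Defs where

open import Data.Nat using (ℕ; zero; suc)
open import Data.List using (List; []; _∷_; concatMap; length)

data Ω₁ : Set where
  R r L l S s : Ω₁

P₁-letter : Ω₁ → List Ω₁
P₁-letter R = R ∷ r ∷ []
P₁-letter r = S ∷ []
P₁-letter L = S ∷ []
P₁-letter l = L ∷ l ∷ []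
P₁-letter S = R ∷ l ∷ []
P₁-letter s = L ∷ r ∷ []

P₁ : List Ω₁ → List Ω₁
P₁ = concatMap P₁-letter

P₁^ : ℕ → List Ω₁ → List Ω₁
P₁^ zero w = w
P₁^ (suc n) w = P₁ (P₁^ n w)

a : ℕ → ℕ
a n = length (P₁^ n (L ∷ []))

-- P₁ is a monoid morphism, so ‖P₁ⁿ⁺¹(x)‖ is the sum of ‖P₁ⁿ(y)‖ over the letters y of
-- P₁(x).  Unfolding L → S → Rl → (Rr)(Ll) and using that r and L both map to S gives
-- a(n+4) = [ℓ(n+1, R) + ℓ(n+1, l)] + 2 ℓ(n, S) = a(n+3) + 2 a(n+1), with ℓ(k, x) = ‖P₁ᵏ(x)‖.
module Submission where

open import Defs
open import Data.Nat using (ℕ; _+_; _*_; _∸_; _≤_; zero; suc; s≤s)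
open import Data.Product using (_×_; _,_)
open import Data.List using (List; []; _∷_; _++_; length)
open import Data.List.Properties using (++-assoc; ++-identityʳ; length-++)
open import Data.Nat.Tactic.RingSolver using (solve-∀)
open import Relation.Binary.PropositionalEquality
open ≡-Reasoning

P₁-++ : ∀ u v → P₁ (u ++ v) ≡ P₁ u ++ P₁ v
P₁-++ []      v = refl
P₁-++ (x ∷ u) v = begin
  P₁-letter x ++ P₁ (u ++ v)       ≡⟨ cong (P₁-letter x ++_) (P₁-++ u v) ⟩
  P₁-letter x ++ (P₁ u ++ P₁ v)    ≡⟨ ++-assoc (P₁-letter x) (P₁ u) (P₁ v) ⟨
  (P₁-letter x ++ P₁ u) ++ P₁ v    ∎

P₁^-++ : ∀ n u v → P₁^ n (u ++ v) ≡ P₁^ n u ++ P₁^ n v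
P₁^-++ zero    u v = refl
P₁^-++ (suc n) u v = trans (cong P₁ (P₁^-++ n u v)) (P₁-++ (P₁^ n u) (P₁^ n v))

P₁^-suc : ∀ n w → P₁^ (suc n) w ≡ P₁^ n (P₁ w)
P₁^-suc zero    w = refl
P₁^-suc (suc n) w = cong P₁ (P₁^-suc n w)

ℓ : ℕ → Ω₁ → ℕ
ℓ n x = length (P₁^ n (x ∷ []))

ℓ-suc : ∀ n x → ℓ (suc n) x ≡ length (P₁^ n (P₁-letter x))
ℓ-suc n x = begin
  length (P₁^ (suc n) (x ∷ []))         ≡⟨ cong length (P₁^-suc n (x ∷ [])) ⟩
  length (P₁^ n (P₁-letter x ++ []))    ≡⟨ cong (λ w → length (P₁^ n w)) (++-identityʳ (P₁-letter x)) ⟩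
  length (P₁^ n (P₁-letter x))          ∎

ℓ-suc-single : ∀ n x y → P₁-letter x ≡ y ∷ [] → ℓ (suc n) x ≡ ℓ n y
ℓ-suc-single n x y eq = trans (ℓ-suc n x) (cong (λ w → length (P₁^ n w)) eq)

ℓ-suc-pair : ∀ n x y z → P₁-letter x ≡ y ∷ z ∷ [] → ℓ (suc n) x ≡ ℓ n y + ℓ n z
ℓ-suc-pair n x y z eq = begin
  ℓ (suc n) x                                      ≡⟨ ℓ-suc n x ⟩
  length (P₁^ n (P₁-letter x))                     ≡⟨ cong (λ w → length (P₁^ n w)) eq ⟩
  length (P₁^ n ((y ∷ []) ++ (z ∷ [])))            ≡⟨ cong length (P₁^-++ n (y ∷ []) (z ∷ [])) ⟩
  length (P₁^ n (y ∷ []) ++ P₁^ n (z ∷ []))        ≡⟨ length-++ (P₁^ n (y ∷ [])) ⟩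
  ℓ n y + ℓ n z                                    ∎

a-recurrence : ∀ n → a (suc (suc (suc (suc n)))) ≡ a (suc (suc (suc n))) + 2 * a (suc n)
a-recurrence n = begin
  ℓ (4 + n) L                                    ≡⟨ ℓ-suc-single (3 + n) L S refl ⟩
  ℓ (3 + n) S                                    ≡⟨ ℓ-suc-pair (2 + n) S R l refl ⟩
  ℓ (2 + n) R + ℓ (2 + n) l                      ≡⟨ cong₂ _+_ (ℓ-suc-pair (1 + n) R R r refl)
                                                              (ℓ-suc-pair (1 + n) l L l refl) ⟩
  (ℓ (1 + n) R + ℓ (1 + n) r) + (ℓ (1 + n) L + ℓ (1 + n) l)
                                                 ≡⟨ cong₂ (λ u v → (ℓ (1 + n) R + u) + (v + ℓ (1 + n) l))
                                                          (ℓ-suc-single n r S refl) (ℓ-suc-single n L S refl) ⟩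
  (ℓ (1 + n) R + ℓ n S) + (ℓ n S + ℓ (1 + n) l)  ≡⟨ regroup (ℓ (1 + n) R) (ℓ n S) (ℓ (1 + n) l) ⟩
  (ℓ (1 + n) R + ℓ (1 + n) l) + 2 * ℓ n S        ≡⟨ cong₂ (λ u v → u + 2 * v)
                                                          a-3+n-unfolded (ℓ-suc-single n L S refl) ⟨
  ℓ (3 + n) L + 2 * ℓ (1 + n) L                  ∎
  where
  regroup : ∀ x y z → (x + y) + (y + z) ≡ (x + z) + 2 * y
  regroup = solve-∀

  a-3+n-unfolded : ℓ (3 + n) L ≡ ℓ (1 + n) R + ℓ (1 + n) l
  a-3+n-unfolded = trans (ℓ-suc-single (2 + n) L S refl) (ℓ-suc-pair (1 + n) S R l refl)

theorem2 : ((n : ℕ) → 4 ≤ n → a n ≡ a (n ∸ 1) + 2 * a (n ∸ 3))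
    × (a 0 ≡ 1) × (a 1 ≡ 1) × (a 2 ≡ 2)
theorem2 = recurrence , refl , refl , refl
  where
  recurrence : (n : ℕ) → 4 ≤ n → a n ≡ a (n ∸ 1) + 2 * a (n ∸ 3)
  recurrence (suc (suc (suc (suc n)))) (s≤s (s≤s (s≤s (s≤s _)))) = a-recurrence n
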